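{- Let $\mathbf{v}=(v_1,\dots,v_m)$ and $\mathbf{k}=(k_1,\dots,k_m)$ be $m$-tuples of positive integers with $\mathbf{v}\ge\mathbf{k}$. Then \[ C(\mathbf{v},\mathbf{k},2)\ge\left\lceil\frac{\sum_{1\le i<j\le m}v_iv_j}{\sum_{1\le i<j\le m}k_ik_j}\right\rceil. \]
   Context: $\mathbf{v}\ge\mathbf{k}$ means componentwise. Generalized covering designs: for $m$-tuples of positive integers $\mathbf{v}$, $\mathbf{k}$ with $k_i\le v_i$ and an integer $t$ with $1\le t\le \sum_i k_i$, let $X_1,\dots,X_m$ be pairwise disjoint sets with $|X_i|=v_i$. A block is an $m$-tuple $(B_1,\dots,B_m)$ with $B_i\subseteq X_i$, $|B_i|=k_i$. An $m$-tuple of sets $(T_1,\dots,T_m)$ is $(\mathbf{v},\mathbf{k},t)$-admissible if $T_i\subseteq X_i$, $|T_i|\le k_i$ and $\sum_i|T_i|=t$; it is contained in a block if $T_i\subseteq B_i$ for all $i$. A ${\rm GC}(\mathbf{v},\mathbf{k},t)$ is a family of blocks (repetitions allowed) such that every admissible tuple is contained in at least one block, and $C(\mathbf{v},\mathbf{k},t)$ is the minimum number of blocks of a ${\rm GC}(\mathbf{v},\mathbf{k},t)$. -}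

module Defs where

open import Data.Nat using (ℕ; zero; suc; _+_; _*_; _≤_)
open import Data.Nat.DivMod using (_/_)
open import Data.Fin using (Fin; zero; suc)
open import Data.Fin.Subset using (Subset; ∣_∣; _⊆_)
open import Data.Product using (Σ; proj₁; _×_)
open import Data.List using (List)
open import Data.List.Relation.Unary.Any using (Any)
open import Relation.Binary.PropositionalEquality using (_≡_)

∑ : (m : ℕ) → (Fin m → ℕ) → ℕ
∑ zero    f = 0
∑ (suc m) f = f zero + ∑ m (λ i → f (suc i))

-- pairSum m f = ∑_{0 ≤ i < j < m} f i * f j
pairSum : (m : ℕ) → (Fin m → ℕ) → ℕ
pairSum zero    f = 0
pairSum (suc m) f = f zero * ∑ m (λ i → f (suc i)) + pairSum m (λ i → f (suc i))

-- ceiling of a / b; convention ⌈a/0⌉ = 0 (only relevant when the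
-- denominator is an empty sum, i.e. m ≤ 1)
ceilDiv : ℕ → ℕ → ℕ
ceilDiv a zero    = 0
ceilDiv a (suc b) = (a + b) / suc b

-- Ground sets X_i = Fin (v i) (disjointness is built in via the index i).
-- A block: an m-tuple (B_1,…,B_m), B_i ⊆ X_i, |B_i| = k_i.
Block : (m : ℕ) → (v k : Fin m → ℕ) → Set
Block m v k = (i : Fin m) → Σ (Subset (v i)) (λ B → ∣ B ∣ ≡ k i)

Tuple : (m : ℕ) → (v : Fin m → ℕ) → Set
Tuple m v = (i : Fin m) → Subset (v i)

Admissible : (m : ℕ) → (v k : Fin m → ℕ) → (t : ℕ) → Tuple m v → Set
Admissible m v k t T = ((i : Fin m) → ∣ T i ∣ ≤ k i) × (∑ m (λ i → ∣ T i ∣) ≡ t)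

ContainedIn : ∀ {m v k} → Tuple m v → Block m v k → Set
ContainedIn {m} T B = (i : Fin m) → T i ⊆ proj₁ (B i)

-- A GC(v,k,t): a family (list, repetitions allowed) of blocks such that
-- every (v,k,t)-admissible tuple is contained in at least one block.
IsGC : (m : ℕ) → (v k : Fin m → ℕ) → (t : ℕ) → List (Block m v k) → Set
IsGC m v k t F = (T : Tuple m v) → Admissible m v k t T → Any (ContainedIn T) F

module Submission where

-- Double counting.  Count the triples (B, x, y) with B ∈ F, x ∈ B_i, y ∈ B_j
-- for some i < j.  A block contributes exactly ∑_{i<j} k_i k_j of them.  For
-- i < j and x ∈ X_i, y ∈ X_j the tuple with T_i = {x}, T_j = {y} and all other
-- parts empty is 2-admissible since k ≥ 1, so some block contains it: each of
-- the ∑_{i<j} v_i v_j cross pairs is counted at least once.  Hence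
-- ∑_{i<j} v_i v_j ≤ |F| · ∑_{i<j} k_i k_j.

open import Defs
open import Data.Nat using (ℕ; _≤_)
open import Data.Fin using (Fin)
open import Data.List using (List; length)

open import Data.Bool using (if_then_else_)
open import Data.Fin using (zero; suc; _<_; _≟_)
open import Data.Fin.Properties using (<⇒≢)
open import Data.Fin.Subset using (Subset; ∣_∣; ⊥; ⁅_⁆; _∪_; _∈_; inside; outside)
open import Data.Fin.Subset.Properties using (∣⊥∣≡0; ∣⁅x⁆∣≡1; x∈⁅x⁆; x∈p∪q⁺; ∪-identityˡ; ∪-identityʳ)
open import Data.List using ([]; _∷_; map)
open import Data.List.Relation.Unary.Any using (Any; here; there)
open import Data.Nat using (zero; suc; _+_; _*_; z≤n; z<s; s<s)
open import Data.Nat.DivMod using (m<n*o⇒m/o<n)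
open import Data.Nat.ListAction using (sum)
open import Data.Nat.Properties
  using (+-comm; +-identityʳ; *-identityʳ; *-zeroʳ; *-distribˡ-+; *-distribʳ-+; ≤-reflexive; ≤-trans;
         m≤m+n; m≤n+m; n<1+n; <⇒≤pred; +-mono-≤; +-monoˡ-≤; +-monoʳ-<; +-commutativeSemigroup; module ≤-Reasoning)
open import Algebra.Properties.CommutativeSemigroup +-commutativeSemigroup using (interchange)
open import Data.Product using (_,_; proj₁; proj₂)
open import Data.Sum using (_⊎_; inj₁; inj₂)
open import Data.Vec using ([]; _∷_; lookup)
open import Data.Vec.Properties using ([]=⇒lookup)
open import Function using (_∘_)
open import Relation.Binary.PropositionalEquality
open import Relation.Nullary using (yes; no; contradiction)

∑-cong : ∀ n {f g : Fin n → ℕ} → (∀ x → f x ≡ g x) → ∑ n f ≡ ∑ n g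
∑-cong zero    f≗g = refl
∑-cong (suc n) f≗g = cong₂ _+_ (f≗g zero) (∑-cong n (f≗g ∘ suc))

∑-mono-≤ : ∀ n {f g : Fin n → ℕ} → (∀ x → f x ≤ g x) → ∑ n f ≤ ∑ n g
∑-mono-≤ zero    f≤g = z≤n
∑-mono-≤ (suc n) f≤g = +-mono-≤ (f≤g zero) (∑-mono-≤ n (f≤g ∘ suc))

∑-distrib-+ : ∀ n (f g : Fin n → ℕ) → ∑ n (λ x → f x + g x) ≡ ∑ n f + ∑ n g
∑-distrib-+ zero    f g = refl
∑-distrib-+ (suc n) f g =
  trans (cong (f zero + g zero +_) (∑-distrib-+ n (f ∘ suc) (g ∘ suc)))
        (interchange (f zero) (g zero) (∑ n (f ∘ suc)) (∑ n (g ∘ suc)))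

∑-const : ∀ n c → ∑ n (λ _ → c) ≡ n * c
∑-const zero    c = refl
∑-const (suc n) c = cong (c +_) (∑-const n c)

∑-zero : ∀ n → ∑ n (λ _ → 0) ≡ 0
∑-zero n = trans (∑-const n 0) (*-zeroʳ n)

*-distribˡ-∑ : ∀ n c (f : Fin n → ℕ) → c * ∑ n f ≡ ∑ n (λ x → c * f x)
*-distribˡ-∑ zero    c f = *-zeroʳ c
*-distribˡ-∑ (suc n) c f =
  trans (*-distribˡ-+ c (f zero) _) (cong (c * f zero +_) (*-distribˡ-∑ n c (f ∘ suc)))

*-distribʳ-∑ : ∀ n c (f : Fin n → ℕ) → ∑ n f * c ≡ ∑ n (λ x → f x * c)
*-distribʳ-∑ zero    c f = refl
*-distribʳ-∑ (suc n) c f =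
  trans (*-distribʳ-+ c (f zero) _) (cong (f zero * c +_) (*-distribʳ-∑ n c (f ∘ suc)))

∑-*-∑ : ∀ m n (f : Fin m → ℕ) (g : Fin n → ℕ) →
        ∑ m f * ∑ n g ≡ ∑ m (λ x → ∑ n (λ y → f x * g y))
∑-*-∑ m n f g = trans (*-distribʳ-∑ m (∑ n g) f) (∑-cong m (λ x → *-distribˡ-∑ n (f x) g))

∑pairs : (m : ℕ) → (Fin m → Fin m → ℕ) → ℕ
∑pairs zero    g = 0
∑pairs (suc m) g = ∑ m (g zero ∘ suc) + ∑pairs m (λ i j → g (suc i) (suc j))

∑pairs-cong : ∀ m {g h : Fin m → Fin m → ℕ} → (∀ i j → g i j ≡ h i j) → ∑pairs m g ≡ ∑pairs m h
∑pairs-cong zero    g≗h = refl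
∑pairs-cong (suc m) g≗h =
  cong₂ _+_ (∑-cong m (g≗h zero ∘ suc)) (∑pairs-cong m (λ i j → g≗h (suc i) (suc j)))

∑pairs-mono-≤ : ∀ m {g h : Fin m → Fin m → ℕ} →
                (∀ {i j} → i < j → g i j ≤ h i j) → ∑pairs m g ≤ ∑pairs m h
∑pairs-mono-≤ zero    g≤h = z≤n
∑pairs-mono-≤ (suc m) g≤h =
  +-mono-≤ (∑-mono-≤ m (λ j → g≤h z<s)) (∑pairs-mono-≤ m (λ i<j → g≤h (s<s i<j)))

∑pairs-distrib-+ : ∀ m (g h : Fin m → Fin m → ℕ) →
                   ∑pairs m (λ i j → g i j + h i j) ≡ ∑pairs m g + ∑pairs m h
∑pairs-distrib-+ zero    g h = refl
∑pairs-distrib-+ (suc m) g h =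
  trans (cong₂ _+_ (∑-distrib-+ m (g zero ∘ suc) (h zero ∘ suc))
                   (∑pairs-distrib-+ m (λ i j → g (suc i) (suc j)) (λ i j → h (suc i) (suc j))))
        (interchange (∑ m (g zero ∘ suc)) (∑ m (h zero ∘ suc)) _ _)

∑pairs-zero : ∀ m → ∑pairs m (λ _ _ → 0) ≡ 0
∑pairs-zero zero    = refl
∑pairs-zero (suc m) = cong₂ _+_ (∑-zero m) (∑pairs-zero m)

pairSum≡∑pairs : ∀ m (f : Fin m → ℕ) → pairSum m f ≡ ∑pairs m (λ i j → f i * f j)
pairSum≡∑pairs zero    f = refl
pairSum≡∑pairs (suc m) f =
  cong₂ _+_ (*-distribˡ-∑ m (f zero) (f ∘ suc)) (pairSum≡∑pairs m (f ∘ suc))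

pairSum-cong : ∀ m {f g : Fin m → ℕ} → (∀ i → f i ≡ g i) → pairSum m f ≡ pairSum m g
pairSum-cong zero    f≗g = refl
pairSum-cong (suc m) f≗g =
  cong₂ _+_ (cong₂ _*_ (f≗g zero) (∑-cong m (f≗g ∘ suc))) (pairSum-cong m (f≗g ∘ suc))

∑crossPairs : ∀ m (v : Fin m → ℕ) → ((i j : Fin m) → Fin (v i) → Fin (v j) → ℕ) → ℕ
∑crossPairs m v h = ∑pairs m (λ i j → ∑ (v i) (λ x → ∑ (v j) (h i j x)))

module _ (m : ℕ) (v : Fin m → ℕ) where

  ∑crossPairs-mono-≤ : ∀ {g h : (i j : Fin m) → Fin (v i) → Fin (v j) → ℕ} →
                       (∀ {i j} → i < j → ∀ x y → g i j x y ≤ h i j x y) →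
                       ∑crossPairs m v g ≤ ∑crossPairs m v h
  ∑crossPairs-mono-≤ g≤h = ∑pairs-mono-≤ m (λ {i} {j} i<j →
    ∑-mono-≤ (v i) (λ x → ∑-mono-≤ (v j) (g≤h i<j x)))

  ∑crossPairs-distrib-+ : ∀ (g h : (i j : Fin m) → Fin (v i) → Fin (v j) → ℕ) →
    ∑crossPairs m v (λ i j x y → g i j x y + h i j x y) ≡ ∑crossPairs m v g + ∑crossPairs m v h
  ∑crossPairs-distrib-+ g h = trans
    (∑pairs-cong m (λ i j → trans
      (∑-cong (v i) (λ x → ∑-distrib-+ (v j) (g i j x) (h i j x)))
      (∑-distrib-+ (v i) _ _)))
    (∑pairs-distrib-+ m _ _)

  ∑crossPairs-zero : ∑crossPairs m v (λ _ _ _ _ → 0) ≡ 0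
  ∑crossPairs-zero = trans
    (∑pairs-cong m (λ i j → trans (∑-cong (v i) (λ _ → ∑-zero (v j))) (∑-zero (v i))))
    (∑pairs-zero m)

  ∑crossPairs-product : ∀ (a : (i : Fin m) → Fin (v i) → ℕ) →
    ∑crossPairs m v (λ i j x y → a i x * a j y) ≡ pairSum m (λ i → ∑ (v i) (a i))
  ∑crossPairs-product a = trans
    (∑pairs-cong m (λ i j → sym (∑-*-∑ (v i) (v j) (a i) (a j))))
    (sym (pairSum≡∑pairs m _))

indicator : ∀ {n} → Subset n → Fin n → ℕ
indicator p x = if lookup p x then 1 else 0

∈⇒indicator≡1 : ∀ {n} {p : Subset n} {x} → x ∈ p → indicator p x ≡ 1
∈⇒indicator≡1 x∈p = cong (if_then 1 else 0) ([]=⇒lookup x∈p)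

∑-indicator : ∀ {n} (p : Subset n) → ∑ n (indicator p) ≡ ∣ p ∣
∑-indicator []            = refl
∑-indicator (inside ∷ p)  = cong suc (∑-indicator p)
∑-indicator (outside ∷ p) = ∑-indicator p

∣p∪q∣≡∣p∣+∣q∣ : ∀ {n} {p q : Subset n} → p ≡ ⊥ ⊎ q ≡ ⊥ → ∣ p ∪ q ∣ ≡ ∣ p ∣ + ∣ q ∣
∣p∪q∣≡∣p∣+∣q∣ {n} {q = q} (inj₁ refl) =
  trans (cong ∣_∣ (∪-identityˡ q)) (cong (_+ ∣ q ∣) (sym (∣⊥∣≡0 n)))
∣p∪q∣≡∣p∣+∣q∣ {n} {p} (inj₂ refl) =
  trans (cong ∣_∣ (∪-identityʳ p)) (trans (sym (+-identityʳ ∣ p ∣)) (cong (∣ p ∣ +_) (sym (∣⊥∣≡0 n))))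

point : ∀ {m} {v : Fin m → ℕ} (i : Fin m) → Fin (v i) → Tuple m v
point             zero    x zero    = ⁅ x ⁆
point             zero    x (suc l) = ⊥
point             (suc i) x zero    = ⊥
point {suc m} {v} (suc i) x (suc l) = point {m} {v ∘ suc} i x l

point-self : ∀ {m} {v : Fin m → ℕ} i (x : Fin (v i)) → point {m} {v} i x i ≡ ⁅ x ⁆
point-self             zero    x = refl
point-self {suc m} {v} (suc i) x = point-self {m} {v ∘ suc} i x

point-other : ∀ {m} {v : Fin m → ℕ} i (x : Fin (v i)) l → i ≢ l → point {m} {v} i x l ≡ ⊥
point-other             zero    x zero    i≢l = contradiction refl i≢l
point-other             zero    x (suc l) i≢l = refl
point-other             (suc i) x zero    i≢l = refl
point-other {suc m} {v} (suc i) x (suc l) i≢l = point-other {m} {v ∘ suc} i x l (i≢l ∘ cong suc)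

∣point∣≤1 : ∀ {m} {v : Fin m → ℕ} i (x : Fin (v i)) l → ∣ point {m} {v} i x l ∣ ≤ 1
∣point∣≤1             zero    x zero    = ≤-reflexive (∣⁅x⁆∣≡1 x)
∣point∣≤1 {v = v}     zero    x (suc l) = subst (_≤ 1) (sym (∣⊥∣≡0 (v (suc l)))) z≤n
∣point∣≤1 {v = v}     (suc i) x zero    = subst (_≤ 1) (sym (∣⊥∣≡0 (v zero))) z≤n
∣point∣≤1 {suc m} {v} (suc i) x (suc l) = ∣point∣≤1 {m} {v ∘ suc} i x l

∑-∣point∣ : ∀ {m} {v : Fin m → ℕ} i (x : Fin (v i)) → ∑ m (λ l → ∣ point {m} {v} i x l ∣) ≡ 1
∑-∣point∣ {suc m} {v} zero    x =
  cong₂ _+_ (∣⁅x⁆∣≡1 x) (trans (∑-cong m (λ l → ∣⊥∣≡0 (v (suc l)))) (∑-zero m))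
∑-∣point∣ {suc m} {v} (suc i) x = cong₂ _+_ (∣⊥∣≡0 (v zero)) (∑-∣point∣ {m} {v ∘ suc} i x)

pairTuple : ∀ {m} {v : Fin m → ℕ} i → Fin (v i) → ∀ j → Fin (v j) → Tuple m v
pairTuple i x j y l = point i x l ∪ point j y l

module _ {m} {v : Fin m → ℕ} (i : Fin m) (x : Fin (v i)) (j : Fin m) (y : Fin (v j)) where

  private
    P Q : Tuple m v
    P = point i x
    Q = point j y

  ∈-pairTupleˡ : x ∈ pairTuple i x j y i
  ∈-pairTupleˡ = x∈p∪q⁺ (inj₁ (subst (x ∈_) (sym (point-self {v = v} i x)) (x∈⁅x⁆ x)))

  ∈-pairTupleʳ : y ∈ pairTuple i x j y j
  ∈-pairTupleʳ = x∈p∪q⁺ {p = P j} (inj₂ (subst (y ∈_) (sym (point-self {v = v} j y)) (x∈⁅x⁆ y)))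

  module _ (i≢j : i ≢ j) where

    point-disjoint : ∀ l → P l ≡ ⊥ ⊎ Q l ≡ ⊥
    point-disjoint l with i ≟ l
    ... | yes refl = inj₂ (point-other j y i (i≢j ∘ sym))
    ... | no  i≢l  = inj₁ (point-other i x l i≢l)

    ∣pairTuple∣≤1 : ∀ l → ∣ P l ∪ Q l ∣ ≤ 1
    ∣pairTuple∣≤1 l with point-disjoint l
    ... | inj₁ eq = begin
      ∣ P l ∪ Q l ∣ ≡⟨ cong (λ p → ∣ p ∪ Q l ∣) eq ⟩
      ∣ ⊥ ∪ Q l ∣   ≡⟨ cong ∣_∣ (∪-identityˡ (Q l)) ⟩
      ∣ Q l ∣       ≤⟨ ∣point∣≤1 j y l ⟩
      1             ∎
      where open ≤-Reasoning
    ... | inj₂ eq = begin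
      ∣ P l ∪ Q l ∣ ≡⟨ cong (λ q → ∣ P l ∪ q ∣) eq ⟩
      ∣ P l ∪ ⊥ ∣   ≡⟨ cong ∣_∣ (∪-identityʳ (P l)) ⟩
      ∣ P l ∣       ≤⟨ ∣point∣≤1 i x l ⟩
      1             ∎
      where open ≤-Reasoning

    pairTuple-admissible : (k : Fin m → ℕ) → (∀ l → 1 ≤ k l) → Admissible m v k 2 (pairTuple i x j y)
    pairTuple-admissible k k≥1 = (λ l → ≤-trans (∣pairTuple∣≤1 l) (k≥1 l)) , (begin
      ∑ m (λ l → ∣ pairTuple i x j y l ∣)
        ≡⟨ ∑-cong m (λ l → ∣p∪q∣≡∣p∣+∣q∣ (point-disjoint l)) ⟩
      ∑ m (λ l → ∣ P l ∣ + ∣ Q l ∣)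
        ≡⟨ ∑-distrib-+ m _ _ ⟩
      ∑ m (λ l → ∣ P l ∣) + ∑ m (λ l → ∣ Q l ∣)
        ≡⟨ cong₂ _+_ (∑-∣point∣ i x) (∑-∣point∣ j y) ⟩
      2 ∎)
      where open ≡-Reasoning

Any⇒1≤sum-map : ∀ {A : Set} {P : A → Set} (f : A → ℕ) {as} →
                Any P as → (∀ a → P a → 1 ≤ f a) → 1 ≤ sum (map f as)
Any⇒1≤sum-map f (here  pa)  1≤f = ≤-trans (1≤f _ pa) (m≤m+n _ _)
Any⇒1≤sum-map f (there any) 1≤f = ≤-trans (Any⇒1≤sum-map f any 1≤f) (m≤n+m _ _)

module _ {m} {v k : Fin m → ℕ} where

  incidence : Block m v k → (i j : Fin m) → Fin (v i) → Fin (v j) → ℕ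
  incidence B i j x y = indicator (proj₁ (B i)) x * indicator (proj₁ (B j)) y

  coverCount : List (Block m v k) → (i j : Fin m) → Fin (v i) → Fin (v j) → ℕ
  coverCount F i j x y = sum (map (λ B → incidence B i j x y) F)

  IsGC⇒1≤coverCount : (∀ l → 1 ≤ k l) → ∀ F → IsGC m v k 2 F →
                      ∀ {i j} → i < j → ∀ x y → 1 ≤ coverCount F i j x y
  IsGC⇒1≤coverCount k≥1 F isGC {i} {j} i<j x y =
    Any⇒1≤sum-map (λ B → incidence B i j x y)
      (isGC (pairTuple i x j y) (pairTuple-admissible i x j y (<⇒≢ i<j) k k≥1)) contains
    where
    contains : ∀ (B : Block m v k) → ContainedIn (pairTuple {v = v} i x j y) B →
               1 ≤ incidence B i j x y
    contains B T⊆B = ≤-reflexive (sym (cong₂ _*_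
      (∈⇒indicator≡1 (T⊆B i (∈-pairTupleˡ {v = v} i x j y)))
      (∈⇒indicator≡1 (T⊆B j (∈-pairTupleʳ {v = v} i x j y)))))

  pairSum≤∑crossPairs-coverCount : (∀ l → 1 ≤ k l) → ∀ F → IsGC m v k 2 F →
                                   pairSum m v ≤ ∑crossPairs m v (coverCount F)
  pairSum≤∑crossPairs-coverCount k≥1 F isGC = begin
    pairSum m v
      ≡⟨ pairSum-cong m (λ i → sym (trans (∑-const (v i) 1) (*-identityʳ (v i)))) ⟩
    pairSum m (λ i → ∑ (v i) (λ _ → 1))
      ≡⟨ sym (∑crossPairs-product m v (λ _ _ → 1)) ⟩
    ∑crossPairs m v (λ _ _ _ _ → 1)
      ≤⟨ ∑crossPairs-mono-≤ m v (IsGC⇒1≤coverCount k≥1 F isGC) ⟩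
    ∑crossPairs m v (coverCount F) ∎
    where open ≤-Reasoning

  ∑crossPairs-coverCount : ∀ F → ∑crossPairs m v (coverCount F) ≡ length F * pairSum m k
  ∑crossPairs-coverCount []      = ∑crossPairs-zero m v
  ∑crossPairs-coverCount (B ∷ F) = trans (∑crossPairs-distrib-+ m v _ _)
    (cong₂ _+_ blockCount (∑crossPairs-coverCount F))
    where
    blockCount : ∑crossPairs m v (incidence B) ≡ pairSum m k
    blockCount = trans (∑crossPairs-product m v (λ i → indicator (proj₁ (B i))))
                       (pairSum-cong m (λ i → trans (∑-indicator (proj₁ (B i))) (proj₂ (B i))))

ceilDiv-≤ : ∀ a b n → a ≤ n * b → ceilDiv a b ≤ n
ceilDiv-≤ a zero    n a≤nb = z≤n
ceilDiv-≤ a (suc b) n a≤nb = <⇒≤pred (m<n*o⇒m/o<n {a + b} {suc n} {suc b} (begin-strict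
  a + b             <⟨ +-monoʳ-< a (n<1+n b) ⟩
  a + suc b         ≤⟨ +-monoˡ-≤ (suc b) a≤nb ⟩
  n * suc b + suc b ≡⟨ +-comm (n * suc b) (suc b) ⟩
  suc n * suc b     ∎))
  where open ≤-Reasoning

proposition4p2 : (m : ℕ) (v k : Fin m → ℕ) →
    ((i : Fin m) → 1 ≤ k i) → ((i : Fin m) → k i ≤ v i) → 2 ≤ ∑ m k →
    (F : List (Block m v k)) → IsGC m v k 2 F →
    ceilDiv (pairSum m v) (pairSum m k) ≤ length F
proposition4p2 m v k k≥1 _ _ F isGC = ceilDiv-≤ (pairSum m v) (pairSum m k) (length F) (begin
  pairSum m v                    ≤⟨ pairSum≤∑crossPairs-coverCount k≥1 F isGC ⟩
  ∑crossPairs m v (coverCount F) ≡⟨ ∑crossPairs-coverCount F ⟩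
  length F * pairSum m k         ∎)
  where open ≤-Reasoning
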